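{- Let $K\subset\mathbb{R}^n$ be convex and let $p\in\mathbb{R}^n$. Let $\epsilon,\delta'>0$, and let $M_p'=\{c\in S_n:\ c^Tk+\delta'<c^Tp\ \text{for all }k\in S(K,\epsilon)\}$. Let $c\in S_n$, and let $k_c\in S(K,\epsilon)$ satisfy the rejection criterion $-\epsilon<-c^T(p-k_c)$. Set $\bar a=(p-k_c)-(c^T(p-k_c))c$. If $m\in M_p'$ and $m^Tc\ge0$, then $m^T\bar a>\delta'-\epsilon$.
   Context: $S_n$ is the Euclidean unit sphere in $\mathbb{R}^n$. For $\epsilon>0$, $S(K,\epsilon)=\bigcup_{x\in K}\{y:\|y-x\|\le\epsilon\}$. In the paper, $k_c$ is the output of a weak optimization oracle for $K$ on input $c$: a point $k_c\in S(K,\epsilon)$ with $c^Tx\le c^Tk_c+\epsilon$ for all $x\in K$. -}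

module Defs where

open import Level using (0ℓ)
open import Data.Nat using (ℕ; zero; suc)
open import Data.Fin using (Fin) renaming (zero to fz; suc to fs)
open import Data.Product using (Σ; ∃; _×_; _,_)
open import Relation.Nullary using (¬_)
open import Relation.Binary.PropositionalEquality using (_≡_)
open import Relation.Binary.Core using (Rel)
open import Relation.Binary.Structures using (IsTotalOrder)
open import Algebra.Structures using (IsCommutativeRing)

-- The real numbers, axiomatised as a complete ordered field
-- (Dedekind-complete: every nonempty bounded-above subset has a supremum).
-- Any model is (classically) isomorphic to ℝ.
record RealField : Set₁ where
  infixl 6 _+_ _-_
  infixl 7 _*_
  infix 4 _≤_ _<_
  field
    ℝ : Set
    _+_ _*_ : ℝ → ℝ → ℝ
    -_ : ℝ → ℝ
    0# 1# : ℝ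
    isCommutativeRing : IsCommutativeRing _≡_ _+_ _*_ -_ 0# 1#
    0≢1 : ¬ (0# ≡ 1#)
    inverse : ∀ x → ¬ (x ≡ 0#) → Σ ℝ (λ y → x * y ≡ 1#)
    _≤_ : Rel ℝ 0ℓ
    isTotalOrder : IsTotalOrder _≡_ _≤_
    +-mono-≤ : ∀ {x y} z → x ≤ y → x + z ≤ y + z
    *-nonneg : ∀ {x y} → 0# ≤ x → 0# ≤ y → 0# ≤ x * y
    sup : (P : ℝ → Set) → Σ ℝ P → Σ ℝ (λ b → ∀ x → P x → x ≤ b) →
          Σ ℝ (λ s → (∀ x → P x → x ≤ s) ×
                     (∀ b → (∀ x → P x → x ≤ b) → s ≤ b))

  _-_ : ℝ → ℝ → ℝ
  x - y = x + (- y)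

  _<_ : Rel ℝ 0ℓ
  x < y = (x ≤ y) × ¬ (x ≡ y)

module Euclidean (R : RealField) where
  open RealField R

  Vecℝ : ℕ → Set
  Vecℝ n = Fin n → ℝ

  _⊕_ : ∀ {n} → Vecℝ n → Vecℝ n → Vecℝ n
  (x ⊕ y) i = x i + y i

  _⊖_ : ∀ {n} → Vecℝ n → Vecℝ n → Vecℝ n
  (x ⊖ y) i = x i - y i

  _·_ : ∀ {n} → ℝ → Vecℝ n → Vecℝ n
  (t · x) i = t * x i

  dot : ∀ {n} → Vecℝ n → Vecℝ n → ℝ
  dot {zero} x y = 0#
  dot {suc n} x y = x fz * y fz + dot {n} (λ i → x (fs i)) (λ i → y (fs i))

  Convex : ∀ {n} → (Vecℝ n → Set) → Set
  Convex K = ∀ x y t → 0# ≤ t → t ≤ 1# → K x → K y → K ((t · x) ⊕ ((1# - t) · y))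

  Sphere : ∀ n → Vecℝ n → Set
  Sphere n c = dot c c ≡ 1#

  -- S(K,ε) = {y : ∃ x ∈ K, ‖y - x‖ ≤ ε}; for ε > 0, ‖v‖ ≤ ε ⇔ vᵀv ≤ ε²
  Nbhd : ∀ {n} → (Vecℝ n → Set) → ℝ → Vecℝ n → Set
  Nbhd K ε y = Σ _ (λ x → K x × (dot (y ⊖ x) (y ⊖ x) ≤ ε * ε))

  M' : ∀ n → (Vecℝ n → Set) → Vecℝ n → ℝ → ℝ → Vecℝ n → Set
  M' n K p ε δ' c = Sphere n c × (∀ k → Nbhd K ε k → dot c k + δ' < dot c p)

{-# OPTIONS --safe #-}
-- Write A = mᵀ(p − k_c), γ = cᵀ(p − k_c) and μ = mᵀc, so that mᵀā = A − γμ by bilinearity.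
-- Testing m ∈ M'_p against k_c ∈ S(K,ε) gives A > δ', and the rejection criterion gives γ < ε.
-- Since m and c are unit vectors, 0 ≤ ‖m − c‖² = 2(1 − μ) gives μ ≤ 1, so with μ ≥ 0 we get
-- γμ ≤ εμ ≤ ε, and therefore mᵀā = A − γμ > δ' − ε.
module Submission where

open import Defs
open import Level using (0ℓ)
open import Data.Nat using (ℕ; zero; suc)
open import Data.Fin using () renaming (zero to fz; suc to fs)
open import Data.Product using (_,_; proj₁)
open import Data.Sum using (inj₁; inj₂)
open import Algebra.Bundles using (CommutativeRing)
open import Algebra.Structures using (IsCommutativeRing)
open import Relation.Binary.Bundles using (Poset)
open import Relation.Binary.Structures using (IsTotalOrder)
open import Relation.Binary.PropositionalEquality using (_≡_; refl; sym; trans; cong; cong₂; subst; subst₂)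
import Algebra.Properties.AbelianGroup as AbelianGroupProperties
import Algebra.Properties.CommutativeSemigroup as CommutativeSemigroupProperties
import Algebra.Properties.Ring as RingProperties
import Relation.Binary.Reasoning.PartialOrder as PosetReasoning

module OrderedFieldProperties (R : RealField) where
  open RealField R

  commutativeRing : CommutativeRing 0ℓ 0ℓ
  commutativeRing = record { isCommutativeRing = isCommutativeRing }

  poset : Poset 0ℓ 0ℓ 0ℓ
  poset = record { isPartialOrder = IsTotalOrder.isPartialOrder isTotalOrder }

  open IsCommutativeRing isCommutativeRing public
    using (+-comm; +-identityˡ; +-identityʳ; -‿inverseʳ; *-comm; *-identityʳ; distribˡ; zeroʳ)
  open IsTotalOrder isTotalOrder public using (total; antisym) renaming (refl to ≤-refl; trans to ≤-trans)
  open AbelianGroupProperties (CommutativeRing.+-abelianGroup commutativeRing) public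
    using (∙-cancelʳ; \\-leftDividesˡ; //-rightDividesˡ; inverseˡ-unique; ⁻¹-injective; ⁻¹-involutive;
           ε⁻¹≈ε; xyx⁻¹≈y; ⁻¹-∙-comm; ⁻¹-anti-homo‿-)
  open CommutativeSemigroupProperties (CommutativeRing.+-commutativeSemigroup commutativeRing) public
    using (interchange)
  open CommutativeSemigroupProperties (CommutativeRing.*-commutativeSemigroup commutativeRing) public
    using (x∙yz≈y∙xz)
  open RingProperties (CommutativeRing.ring commutativeRing) public
    using (-‿distribˡ-*; -‿distribʳ-*; x[y-z]≈xy-xz; [y-z]x≈yx-zx)
  open PosetReasoning poset public

  [x-y]+[z-w]≡[x+z]-[y+w] : ∀ x y z w → (x - y) + (z - w) ≡ (x + z) - (y + w)
  [x-y]+[z-w]≡[x+z]-[y+w] x y z w =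
    trans (interchange x (- y) z (- w)) (cong ((x + z) +_) (⁻¹-∙-comm y w))

  -x*-x≡x*x : ∀ x → - x * - x ≡ x * x
  -x*-x≡x*x x = begin-equality
    - x * - x     ≡⟨ sym (-‿distribˡ-* x (- x)) ⟩
    - (x * - x)   ≡⟨ cong -_ (sym (-‿distribʳ-* x x)) ⟩
    - - (x * x)   ≡⟨ ⁻¹-involutive (x * x) ⟩
    x * x         ∎

  +-monoʳ-≤ : ∀ z {x y} → x ≤ y → z + x ≤ z + y
  +-monoʳ-≤ z {x} {y} x≤y = subst₂ _≤_ (+-comm x z) (+-comm y z) (+-mono-≤ z x≤y)

  +-monoˡ-< : ∀ z {x y} → x < y → x + z < y + z
  +-monoˡ-< z {x} {y} (x≤y , x≢y) =
    +-mono-≤ z x≤y , λ x+z≡y+z → x≢y (∙-cancelʳ z x y x+z≡y+z)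

  +-nonneg : ∀ {x y} → 0# ≤ x → 0# ≤ y → 0# ≤ x + y
  +-nonneg {x} {y} 0≤x 0≤y = begin
    0#       ≡⟨ sym (+-identityʳ 0#) ⟩
    0# + 0#  ≤⟨ +-mono-≤ 0# 0≤x ⟩
    x + 0#   ≤⟨ +-monoʳ-≤ x 0≤y ⟩
    x + y    ∎

  x≤y⇒0≤y-x : ∀ {x y} → x ≤ y → 0# ≤ y - x
  x≤y⇒0≤y-x {x} {y} x≤y = subst (_≤ y - x) (-‿inverseʳ x) (+-mono-≤ (- x) x≤y)

  0≤y-x⇒x≤y : ∀ {x y} → 0# ≤ y - x → x ≤ y
  0≤y-x⇒x≤y {x} {y} 0≤y-x = subst₂ _≤_ (+-identityˡ x) (//-rightDividesˡ x y) (+-mono-≤ x 0≤y-x)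

  neg-antimono-≤ : ∀ {x y} → x ≤ y → - y ≤ - x
  neg-antimono-≤ {x} {y} x≤y = begin
    - y                ≡⟨ sym (\\-leftDividesˡ x (- y)) ⟩
    x + (- x + - y)    ≤⟨ +-mono-≤ (- x + - y) x≤y ⟩
    y + (- x + - y)    ≡⟨ cong (y +_) (+-comm (- x) (- y)) ⟩
    y + (- y + - x)    ≡⟨ \\-leftDividesˡ y (- x) ⟩
    - x                ∎

  neg-antimono-< : ∀ {x y} → x < y → - y < - x
  neg-antimono-< (x≤y , x≢y) = neg-antimono-≤ x≤y , λ -y≡-x → x≢y (sym (⁻¹-injective -y≡-x))

  neg-cancel-< : ∀ {x y} → - x < - y → y < x
  neg-cancel-< {x} {y} -x<-y = subst₂ _<_ (⁻¹-involutive y) (⁻¹-involutive x) (neg-antimono-< -x<-y)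

  x+y<z⇒y<z-x : ∀ {x y z} → x + y < z → y < z - x
  x+y<z⇒y<z-x {x} {y} {z} x+y<z = subst (_< z - x) (xyx⁻¹≈y x y) (+-monoˡ-< (- x) x+y<z)

  x≤0⇒0≤-x : ∀ {x} → x ≤ 0# → 0# ≤ - x
  x≤0⇒0≤-x x≤0 = subst (_≤ _) ε⁻¹≈ε (neg-antimono-≤ x≤0)

  *-monoˡ-≤-nonNeg : ∀ {t x y} → 0# ≤ t → x ≤ y → x * t ≤ y * t
  *-monoˡ-≤-nonNeg {t} {x} {y} 0≤t x≤y =
    0≤y-x⇒x≤y (subst (0# ≤_) ([y-z]x≈yx-zx t y x) (*-nonneg (x≤y⇒0≤y-x x≤y) 0≤t))

  *-monoʳ-≤-nonNeg : ∀ {t x y} → 0# ≤ t → x ≤ y → t * x ≤ t * y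
  *-monoʳ-≤-nonNeg {t} {x} {y} 0≤t x≤y =
    subst₂ _≤_ (*-comm x t) (*-comm y t) (*-monoˡ-≤-nonNeg 0≤t x≤y)

  x*x-nonneg : ∀ x → 0# ≤ x * x
  x*x-nonneg x with total 0# x
  ... | inj₁ 0≤x = *-nonneg 0≤x 0≤x
  ... | inj₂ x≤0 = subst (0# ≤_) (-x*-x≡x*x x) (*-nonneg (x≤0⇒0≤-x x≤0) (x≤0⇒0≤-x x≤0))

  0≤x+x⇒0≤x : ∀ {x} → 0# ≤ x + x → 0# ≤ x
  0≤x+x⇒0≤x {x} 0≤x+x with total 0# x
  ... | inj₁ 0≤x = 0≤x
  ... | inj₂ x≤0 = subst (0# ≤_) (sym x≡-x) (x≤0⇒0≤-x x≤0)
    where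
    x+x≤0 : x + x ≤ 0#
    x+x≤0 = ≤-trans (+-mono-≤ x x≤0) (subst (_≤ 0#) (sym (+-identityˡ x)) x≤0)
    x≡-x : x ≡ - x
    x≡-x = inverseˡ-unique x x (antisym x+x≤0 0≤x+x)

module EuclideanProperties (R : RealField) where
  open RealField R
  open Euclidean R
  open OrderedFieldProperties R

  dot-comm : ∀ {n} (x y : Vecℝ n) → dot x y ≡ dot y x
  dot-comm {zero}  x y = refl
  dot-comm {suc n} x y = cong₂ _+_ (*-comm (x fz) (y fz)) (dot-comm (λ i → x (fs i)) (λ i → y (fs i)))

  dot-distribʳ-⊖ : ∀ {n} (m a b : Vecℝ n) → dot m (a ⊖ b) ≡ dot m a - dot m b
  dot-distribʳ-⊖ {zero}  m a b = sym (-‿inverseʳ 0#)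
  dot-distribʳ-⊖ {suc n} m a b = begin-equality
    m fz * (a fz - b fz) + dot m′ (a′ ⊖ b′)
      ≡⟨ cong₂ _+_ (x[y-z]≈xy-xz (m fz) (a fz) (b fz)) (dot-distribʳ-⊖ m′ a′ b′) ⟩
    (m fz * a fz - m fz * b fz) + (dot m′ a′ - dot m′ b′)
      ≡⟨ [x-y]+[z-w]≡[x+z]-[y+w] _ _ _ _ ⟩
    (m fz * a fz + dot m′ a′) - (m fz * b fz + dot m′ b′) ∎
    where
    m′ a′ b′ : Vecℝ n
    m′ i = m (fs i)
    a′ i = a (fs i)
    b′ i = b (fs i)

  dot-distribˡ-⊖ : ∀ {n} (a b m : Vecℝ n) → dot (a ⊖ b) m ≡ dot a m - dot b m
  dot-distribˡ-⊖ a b m = begin-equality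
    dot (a ⊖ b) m        ≡⟨ dot-comm (a ⊖ b) m ⟩
    dot m (a ⊖ b)        ≡⟨ dot-distribʳ-⊖ m a b ⟩
    dot m a - dot m b    ≡⟨ cong₂ _-_ (dot-comm m a) (dot-comm m b) ⟩
    dot a m - dot b m    ∎

  dot-·ʳ : ∀ {n} (m c : Vecℝ n) t → dot m (t · c) ≡ t * dot m c
  dot-·ʳ {zero}  m c t = sym (zeroʳ t)
  dot-·ʳ {suc n} m c t = begin-equality
    m fz * (t * c fz) + dot m′ (t · c′)   ≡⟨ cong₂ _+_ (x∙yz≈y∙xz (m fz) t (c fz)) (dot-·ʳ m′ c′ t) ⟩
    t * (m fz * c fz) + t * dot m′ c′     ≡⟨ sym (distribˡ t _ _) ⟩
    t * (m fz * c fz + dot m′ c′)         ∎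
    where
    m′ c′ : Vecℝ n
    m′ i = m (fs i)
    c′ i = c (fs i)

  dot-self-nonneg : ∀ {n} (v : Vecℝ n) → 0# ≤ dot v v
  dot-self-nonneg {zero}  v = ≤-refl
  dot-self-nonneg {suc n} v = +-nonneg (x*x-nonneg (v fz)) (dot-self-nonneg (λ i → v (fs i)))

  Sphere⇒dot≤1 : ∀ {n} (m c : Vecℝ n) → Sphere n m → Sphere n c → dot m c ≤ 1#
  Sphere⇒dot≤1 m c m∈S c∈S = 0≤y-x⇒x≤y (0≤x+x⇒0≤x (begin
    0#                                       ≤⟨ dot-self-nonneg (m ⊖ c) ⟩
    dot (m ⊖ c) (m ⊖ c)                      ≡⟨ dot-distribˡ-⊖ m c (m ⊖ c) ⟩
    dot m (m ⊖ c) - dot c (m ⊖ c)            ≡⟨ cong₂ _-_ (dot-distribʳ-⊖ m m c) (dot-distribʳ-⊖ c m c) ⟩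
    (dot m m - dot m c) - (dot c m - dot c c)
      ≡⟨ cong₂ _-_ (cong (_- dot m c) m∈S) (cong₂ _-_ (dot-comm c m) c∈S) ⟩
    (1# - dot m c) - (dot m c - 1#)
      ≡⟨ cong ((1# - dot m c) +_) (⁻¹-anti-homo‿- (dot m c) 1#) ⟩
    (1# - dot m c) + (1# - dot m c)          ∎))

lemma5p15 : (R : RealField) → let open RealField R in let open Euclidean R in
    (n : ℕ) (K : Vecℝ n → Set) → Convex K → (p : Vecℝ n) (ε δ' : ℝ) →
    0# < ε → 0# < δ' →
    (c : Vecℝ n) → Sphere n c →
    (kc : Vecℝ n) → Nbhd K ε kc →
    (- ε) < - dot c (p ⊖ kc) →
    (m : Vecℝ n) → M' n K p ε δ' m → 0# ≤ dot m c →
    δ' - ε < dot m ((p ⊖ kc) ⊖ (dot c (p ⊖ kc) · c))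
lemma5p15 R _ _ _ p ε δ' 0<ε _ c c∈S kc kc∈S rejected m (m∈S , separates) 0≤μ = begin-strict
  δ' - ε                       ≤⟨ +-monoʳ-≤ δ' (neg-antimono-≤ γμ≤ε) ⟩
  δ' - γ * μ                   <⟨ +-monoˡ-< (- (γ * μ)) δ'<A ⟩
  A - γ * μ                    ≡⟨ cong (λ t → A - t) (sym (dot-·ʳ m c γ)) ⟩
  A - dot m (γ · c)            ≡⟨ sym (dot-distribʳ-⊖ m (p ⊖ kc) (γ · c)) ⟩
  dot m ((p ⊖ kc) ⊖ (γ · c))   ∎
  where
  open RealField R
  open Euclidean R
  open OrderedFieldProperties R
  open EuclideanProperties R

  A γ μ : ℝ
  A = dot m (p ⊖ kc)
  γ = dot c (p ⊖ kc)
  μ = dot m c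

  δ'<A : δ' < A
  δ'<A = subst (δ' <_) (sym (dot-distribʳ-⊖ m p kc)) (x+y<z⇒y<z-x (separates kc kc∈S))

  γμ≤ε : γ * μ ≤ ε
  γμ≤ε = begin
    γ * μ   ≤⟨ *-monoˡ-≤-nonNeg 0≤μ (proj₁ (neg-cancel-< rejected)) ⟩
    ε * μ   ≤⟨ *-monoʳ-≤-nonNeg (proj₁ 0<ε) (Sphere⇒dot≤1 m c m∈S c∈S) ⟩
    ε * 1#  ≡⟨ *-identityʳ ε ⟩
    ε       ∎
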